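{- (i) For every $n\geq 2$, $St_d^t(F_n)=1$. (ii) For every $n\geq 3$, $St_d^t(B_n)=1$.
   Context: The friendship graph $F_n$ ($n\ge 2$) is obtained by joining $n$ copies of the cycle $C_3$ at a common vertex. The $n$-book graph $B_n$ ($n\ge2$) is the Cartesian product $K_{1,n}\square P_2$. A total dominator coloring (TD-coloring) of a graph $G$ with no isolated vertex is a proper vertex coloring of $G$ in which every vertex of $G$ is adjacent to every vertex of some (other) color class. The total dominator chromatic (TDC) number $\chi_d^t(G)$ is the minimum number of color classes in a TD-coloring of $G$. The TDC-stability $St_d^t(G)$ of $G$ is the minimum number of vertices of $G$ whose removal changes the TDC-number of $G$. -}

module Defs where

open import Data.Nat using (ℕ; zero; suc; _+_; _*_; _<_; _≤_)
open import Data.Fin using (Fin; zero; suc; remQuot)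
open import Data.Fin.Subset using (Subset; _∉_; ∣_∣)
open import Data.Product using (Σ; ∃; _×_; _,_; proj₁; proj₂)
open import Data.Sum using (_⊎_)
open import Data.Empty using (⊥)
open import Data.Unit using (⊤)
open import Relation.Nullary using (¬_)
open import Relation.Binary.PropositionalEquality using (_≡_; _≢_)

record Graph (n : ℕ) : Set₁ where
  field
    Adj : Fin n → Fin n → Set

open Graph public

Proper : {V : Set} (E : V → V → Set) {k : ℕ} → (V → Fin k) → Set
Proper {V} E c = ∀ (u v : V) → E u v → c u ≢ c v

AllClassesNonempty : {V : Set} {k : ℕ} → (V → Fin k) → Set
AllClassesNonempty {V} {k} c = ∀ (i : Fin k) → ∃ λ (v : V) → c v ≡ i

TotallyDominating : {V : Set} (E : V → V → Set) {k : ℕ} → (V → Fin k) → Set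
TotallyDominating {V} E {k} c =
  ∀ (v : V) → ∃ λ (i : Fin k) → ∀ (u : V) → c u ≡ i → E v u

IsTDColoring : {V : Set} (E : V → V → Set) {k : ℕ} → (V → Fin k) → Set
IsTDColoring E c = Proper E c × AllClassesNonempty c × TotallyDominating E c

HasTDColoring : {V : Set} (E : V → V → Set) (k : ℕ) → Set
HasTDColoring {V} E k = ∃ λ (c : V → Fin k) → IsTDColoring E c

IsTDCNumber : {V : Set} (E : V → V → Set) (k : ℕ) → Set
IsTDCNumber E k = HasTDColoring E k × (∀ m → m < k → ¬ HasTDColoring E m)

RemV : {n : ℕ} → Subset n → Set
RemV {n} S = Σ (Fin n) (λ v → v ∉ S)

RemAdj : {n : ℕ} (G : Graph n) (S : Subset n) → RemV S → RemV S → Set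
RemAdj G S (u , _) (v , _) = Adj G u v

ChangesTDC : {n : ℕ} (G : Graph n) (S : Subset n) → Set
ChangesTDC G S =
  ∃ λ (χ : ℕ) → IsTDCNumber (Adj G) χ ×
  ∃ λ (χ' : ℕ) → IsTDCNumber (RemAdj G S) χ' × χ' ≢ χ

IsTDCStability : {n : ℕ} (G : Graph n) (k : ℕ) → Set
IsTDCStability {n} G k =
  (∃ λ (S : Subset n) → ∣ S ∣ ≡ k × ChangesTDC G S) ×
  (∀ (S : Subset n) → ∣ S ∣ < k → ¬ ChangesTDC G S)

-- Friendship graph F_n on Fin (suc (n * 2)) (2n+1 vertices):
-- vertex zero is the common vertex; vertex suc x with remQuot 2 x = (t , s)
-- is the s-th non-central vertex of the t-th triangle.

FriendshipAdj : (n : ℕ) → Fin (suc (n * 2)) → Fin (suc (n * 2)) → Set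
FriendshipAdj n zero    zero    = ⊥
FriendshipAdj n zero    (suc y) = ⊤
FriendshipAdj n (suc x) zero    = ⊤
FriendshipAdj n (suc x) (suc y) =
  proj₁ (remQuot {n} 2 x) ≡ proj₁ (remQuot {n} 2 y) ×
  proj₂ (remQuot {n} 2 x) ≢ proj₂ (remQuot {n} 2 y)

Friendship : (n : ℕ) → Graph (suc (n * 2))
Friendship n = record { Adj = FriendshipAdj n }

-- Book graph B_n = K_{1,n} □ P_2 on Fin (suc n * 2), a vertex x
-- corresponding to the pair remQuot 2 x : Fin (suc n) × Fin 2.

StarAdj : (n : ℕ) → Fin (suc n) → Fin (suc n) → Set
StarAdj n zero    zero    = ⊥
StarAdj n zero    (suc y) = ⊤
StarAdj n (suc x) zero    = ⊤
StarAdj n (suc x) (suc y) = ⊥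

P2Adj : Fin 2 → Fin 2 → Set
P2Adj a b = a ≢ b

CartAdj : {A B : Set} → (A → A → Set) → (B → B → Set) → A × B → A × B → Set
CartAdj EA EB (a , b) (a' , b') = (a ≡ a' × EB b b') ⊎ (EA a a' × b ≡ b')

BookAdj : (n : ℕ) → Fin (suc n * 2) → Fin (suc n * 2) → Set
BookAdj n x y = CartAdj (StarAdj n) P2Adj (remQuot {suc n} 2 x) (remQuot {suc n} 2 y)

Book : (n : ℕ) → Graph (suc n * 2)
Book n = record { Adj = BookAdj n }

-- Deleting a hub changes χ_d^t in both families. F_n has χ_d^t = 3: a triangle forces three
-- classes, and colouring hub / left / right vertices suffices. F_n minus its hub is nK₂,
-- where the only class that can dominate a vertex is its partner's, so all 2n classes are
-- distinct. B_n has χ_d^t = 4, whereas B_n minus a hub is the subdivided star S(K_{1,n}),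
-- whose pendant vertices again force n pairwise distinct dominating classes, and two more
-- classes are needed around the centre: n + 2 ≠ 4 for n ≥ 3. Deleting no vertex changes
-- nothing, so one deleted vertex is the minimum.
module Submission where

open import Defs
open import Data.Empty using (⊥; ⊥-elim)
open import Data.Fin using (Fin; zero; suc; combine; remQuot; opposite; _≟_)
open import Data.Fin.Properties
  using (remQuot-combine; combine-remQuot; combine-injective; injective⇒≤; suc-injective)
open import Data.Fin.Subset using (Subset; _∈_; _∉_; ∣_∣; ⁅_⁆; inside; outside)
open import Data.Fin.Subset.Properties using (∣⁅x⁆∣≡1; x∈⁅x⁆; x≢y⇒x∉⁅y⁆)
open import Data.Maybe using (Maybe; just; nothing)
open import Data.Nat using (ℕ; zero; suc; _+_; _≤_; _*_; s≤s)
open import Data.Nat.Properties using (<-cmp; ≤⇒≯; n<1⇒n≡0)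
open import Data.Product using (_×_; _,_; proj₁; proj₂; uncurry)
open import Data.Sum using (inj₁; inj₂)
open import Data.Unit using (⊤; tt)
open import Data.Vec.Base using (_∷_; there)
import Data.Vec.Functional as Vector
open import Function using (_∘_)
open import Function.Definitions using (Injective)
open import Relation.Binary.Definitions using (tri<; tri≈; tri>)
open import Relation.Binary.PropositionalEquality
  using (_≡_; _≢_; refl; sym; trans; cong; subst; subst₂; module ≡-Reasoning)
open import Relation.Nullary using (¬_; Dec; yes; no)

module _ {m : ℕ} where

  []-injective : Injective _≡_ _≡_ (Vector.[] {A = Fin m})
  []-injective {()}

  ∷-injective : ∀ {n} {a : Fin m} {h : Fin n → Fin m} →
                (∀ i → a ≢ h i) → Injective _≡_ _≡_ h → Injective _≡_ _≡_ (a Vector.∷ h)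
  ∷-injective fresh inj {zero}  {zero}  _ = refl
  ∷-injective fresh inj {zero}  {suc j} e = ⊥-elim (fresh j e)
  ∷-injective fresh inj {suc i} {zero}  e = ⊥-elim (fresh i (sym e))
  ∷-injective fresh inj {suc i} {suc j} e = cong suc (inj e)

  distinct₃⇒3≤ : ∀ {a b c : Fin m} → a ≢ b → a ≢ c → b ≢ c → 3 ≤ m
  distinct₃⇒3≤ a≢b a≢c b≢c = injective⇒≤
    (∷-injective (λ { zero → a≢b ; (suc zero) → a≢c })
    (∷-injective (λ { zero → b≢c })
    (∷-injective (λ ()) []-injective)))

  distinct₄⇒4≤ : ∀ {a b c d : Fin m} →
                 a ≢ b → a ≢ c → a ≢ d → b ≢ c → b ≢ d → c ≢ d → 4 ≤ m
  distinct₄⇒4≤ a≢b a≢c a≢d b≢c b≢d c≢d = injective⇒≤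
    (∷-injective (λ { zero → a≢b ; (suc zero) → a≢c ; (suc (suc zero)) → a≢d })
    (∷-injective (λ { zero → b≢c ; (suc zero) → b≢d })
    (∷-injective (λ { zero → c≢d })
    (∷-injective (λ ()) []-injective))))

  two-outside-image⇒2+n≤ : ∀ {n} {a b : Fin m} {h : Fin n → Fin m} → a ≢ b →
                           (∀ i → a ≢ h i) → (∀ i → b ≢ h i) → Injective _≡_ _≡_ h →
                           2 + n ≤ m
  two-outside-image⇒2+n≤ a≢b a∉h b∉h D-outer-injective = injective⇒≤
    (∷-injective (λ { zero → a≢b ; (suc i) → a∉h i }) (∷-injective b∉h D-outer-injective))

triangle⇒3≤ : ∀ {V : Set} {E : V → V → Set} {m} {c : V → Fin m} → Proper E c →
              ∀ {u v w} → E u v → E u w → E v w → 3 ≤ m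
triangle⇒3≤ proper uv uw vw = distinct₃⇒3≤ (proper _ _ uv) (proper _ _ uw) (proper _ _ vw)

-- The trace on E of a TD-coloring of a graph fully retracting onto E (FullRetraction.shadow):
-- colours are read through the section, and rep i is the image of a vertex of class i, so
-- the classes colour⁻¹ i ∪ {rep i} may overlap. Lower bounds are proved for these because
-- from ∘ to is not provably the identity (on G - S with S empty it replaces the proof of
-- non-membership), so a TD-coloring of the bigger graph cannot be moved onto E itself.
record WeakTDColoring {V : Set} (E : V → V → Set) (m : ℕ) : Set where
  field
    colour        : V → Fin m
    proper        : Proper E colour
    dominator     : V → Fin m
    dominates     : ∀ v u → colour u ≡ dominator v → E v u
    rep           : Fin m → V
    dominates-rep : ∀ v → E v (rep (dominator v))

  dominator≢colour : ∀ {v u} → ¬ E v u → dominator v ≢ colour u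
  dominator≢colour ¬vu eq = ¬vu (dominates _ _ (sym eq))

  rep-dominator-of-pendant : ∀ {v p} → (∀ {u} → E v u → u ≡ p) → rep (dominator v) ≡ p
  rep-dominator-of-pendant only-p = only-p (dominates-rep _)

  pendant-dominators-injective : ∀ {I : Set} (leaf neighbour : I → V) →
    Injective _≡_ _≡_ neighbour → (∀ i {u} → E (leaf i) u → u ≡ neighbour i) →
    Injective _≡_ _≡_ (dominator ∘ leaf)
  pendant-dominators-injective leaf neighbour neighbour-injective pendant {i} {j} eq =
    neighbour-injective (begin
      neighbour i             ≡⟨ sym (rep-dominator-of-pendant (pendant i)) ⟩
      rep (dominator (leaf i)) ≡⟨ cong rep eq ⟩
      rep (dominator (leaf j)) ≡⟨ rep-dominator-of-pendant (pendant j) ⟩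
      neighbour j             ∎)
    where open ≡-Reasoning

record FullRetraction {W V : Set} (E′ : W → W → Set) (E : V → V → Set) : Set where
  field
    to        : W → V
    from      : V → W
    to∘from   : ∀ v → to (from v) ≡ v
    preserves : ∀ {u w} → E′ u w → E (to u) (to w)
    reflects  : ∀ {u w} → E (to u) (to w) → E′ u w

  from-preserves : ∀ {u v} → E u v → E′ (from u) (from v)
  from-preserves {u} {v} e = reflects (subst₂ E (sym (to∘from u)) (sym (to∘from v)) e)

  pullback : ∀ {k} → HasTDColoring E k → HasTDColoring E′ k
  pullback (c , proper , nonempty , dominating) =
    c ∘ to ,
    (λ u w e → proper _ _ (preserves e)) ,
    (λ i → from (proj₁ (nonempty i)) ,
           trans (cong c (to∘from (proj₁ (nonempty i)))) (proj₂ (nonempty i))) ,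
    (λ w → proj₁ (dominating (to w)) ,
           λ u cu≡i → reflects (proj₂ (dominating (to w)) (to u) cu≡i))

  shadow : ∀ {m} → HasTDColoring E′ m → WeakTDColoring E m
  shadow {m} (c , proper , nonempty , dominating) = record
    { colour        = c ∘ from
    ; proper        = λ u v e → proper _ _ (from-preserves e)
    ; dominator     = dominator
    ; dominates     = λ v u eq → subst (E v) (to∘from u) (dominated v (from u) eq)
    ; rep           = λ i → to (proj₁ (nonempty i))
    ; dominates-rep = λ v → dominated v _ (proj₂ (nonempty (dominator v)))
    }
    where
    dominator : V → Fin m
    dominator v = proj₁ (dominating (from v))
    dominated : ∀ v w → c w ≡ dominator v → E v (to w)
    dominated v w eq =
      subst (λ x → E x (to w)) (to∘from v) (preserves (proj₂ (dominating (from v)) w eq))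

open FullRetraction using (pullback; shadow)

full-retraction-by-≡ : ∀ {W V : Set} {E′ : W → W → Set} {E : V → V → Set}
  (to : W → V) (from : V → W) → (∀ v → to (from v) ≡ v) →
  (∀ u w → E′ u w ≡ E (to u) (to w)) → FullRetraction E′ E
full-retraction-by-≡ to from to∘from same-adjacency = record
  { to        = to
  ; from      = from
  ; to∘from   = to∘from
  ; preserves = λ {u} {w} → subst (λ A → A) (same-adjacency u w)
  ; reflects  = λ {u} {w} → subst (λ A → A) (sym (same-adjacency u w))
  }

∣p∣≡0⇒x∉p : ∀ {n} {p : Subset n} {x : Fin n} → ∣ p ∣ ≡ 0 → x ∉ p
∣p∣≡0⇒x∉p {p = inside  ∷ _} ()
∣p∣≡0⇒x∉p {p = outside ∷ p} ∣p∣≡0 (there x∈p) = ∣p∣≡0⇒x∉p {p = p} ∣p∣≡0 x∈p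

remove-empty-set : ∀ {n} {G : Graph n} {V : Set} {E : V → V → Set} (S : Subset n) →
                   ∣ S ∣ ≡ 0 → FullRetraction (Adj G) E → FullRetraction (RemAdj G S) E
remove-empty-set S ∣S∣≡0 R = record
  { to        = to ∘ proj₁
  ; from      = λ v → from v , ∣p∣≡0⇒x∉p {p = S} ∣S∣≡0
  ; to∘from   = to∘from
  ; preserves = preserves
  ; reflects  = reflects
  }
  where open FullRetraction R

record TDCBounds {V : Set} (E : V → V → Set) (k : ℕ) : Set where
  field
    coloring : HasTDColoring E k
    lower    : ∀ {m} → WeakTDColoring E m → k ≤ m

tdcNumber-of-retraction : ∀ {W V : Set} {E′ : W → W → Set} {E : V → V → Set} {k} →
                          FullRetraction E′ E → TDCBounds E k → IsTDCNumber E′ k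
tdcNumber-of-retraction R B =
  pullback R (TDCBounds.coloring B) ,
  λ m m<k c → ≤⇒≯ (TDCBounds.lower B (shadow R c)) m<k

tdcNumber-unique : ∀ {V : Set} {E : V → V → Set} {a b} →
                   IsTDCNumber E a → IsTDCNumber E b → a ≡ b
tdcNumber-unique {a = a} {b} (has-a , min-a) (has-b , min-b) with <-cmp a b
... | tri< a<b _ _ = ⊥-elim (min-b a a<b has-a)
... | tri≈ _ a≡b _ = a≡b
... | tri> _ _ b<a = ⊥-elim (min-a b b<a has-b)

tdcStability≡1 : ∀ {n} {G : Graph n} (v : Fin n)
  {V V₀ : Set} {E : V → V → Set} {E₀ : V₀ → V₀ → Set} {k k₀ : ℕ} →
  FullRetraction (Adj G) E → TDCBounds E k →
  FullRetraction (RemAdj G ⁅ v ⁆) E₀ → TDCBounds E₀ k₀ → k₀ ≢ k →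
  IsTDCStability G 1
tdcStability≡1 {G = G} v {k = k} R B R₀ B₀ k₀≢k =
  (⁅ v ⁆ , ∣⁅x⁆∣≡1 v , _ , χ-G , _ , tdcNumber-of-retraction R₀ B₀ , k₀≢k) ,
  λ S ∣S∣<1 (χ , χ-G′ , χ′ , χ-G-S , χ′≢χ) → χ′≢χ (begin
    χ′ ≡⟨ tdcNumber-unique χ-G-S
            (tdcNumber-of-retraction (remove-empty-set S (n<1⇒n≡0 ∣S∣<1) R) B) ⟩
    k  ≡⟨ tdcNumber-unique χ-G χ-G′ ⟩
    χ  ∎)
  where
  open ≡-Reasoning
  χ-G : IsTDCNumber (Adj G) k
  χ-G = tdcNumber-of-retraction R B

MatchingAdj : ∀ n → Fin n × Fin 2 → Fin n × Fin 2 → Set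
MatchingAdj n (t , s) (t′ , s′) = t ≡ t′ × s ≢ s′

ExtendAdj : {V : Set} → (V → Set) → (V → V → Set) → Maybe V → Maybe V → Set
ExtendAdj N E nothing  nothing  = ⊥
ExtendAdj N E nothing  (just v) = N v
ExtendAdj N E (just u) nothing  = N u
ExtendAdj N E (just u) (just v) = E u v

ConeAdj : {V : Set} → (V → V → Set) → Maybe V → Maybe V → Set
ConeAdj = ExtendAdj (λ _ → ⊤)

-- The centre nothing joined to each (i , 1), which carries the pendant vertex (i , 0).
SubdividedStarAdj : ∀ n → Maybe (Fin n × Fin 2) → Maybe (Fin n × Fin 2) → Set
SubdividedStarAdj n = ExtendAdj (λ (_ , s) → s ≡ suc zero) (MatchingAdj n)

BookModelAdj : ∀ n → Fin (suc n) × Fin 2 → Fin (suc n) × Fin 2 → Set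
BookModelAdj n = CartAdj (StarAdj n) P2Adj

≢opposite : ∀ (s : Fin 2) → s ≢ opposite s
≢opposite zero       ()
≢opposite (suc zero) ()

opposite≢⇒≡ : ∀ (s t : Fin 2) → opposite s ≢ t → t ≡ s
opposite≢⇒≡ zero       zero       _   = refl
opposite≢⇒≡ zero       (suc zero) s̄≢t = ⊥-elim (s̄≢t refl)
opposite≢⇒≡ (suc zero) zero       s̄≢t = ⊥-elim (s̄≢t refl)
opposite≢⇒≡ (suc zero) (suc zero) _   = refl

partner : ∀ {n} → Fin n × Fin 2 → Fin n × Fin 2
partner (t , s) = t , opposite s

partner-unique-neighbour : ∀ {n} p {u} → MatchingAdj n (partner p) u → u ≡ p
partner-unique-neighbour (t , s) {.t , s′} (refl , s̄≢s′) = cong (t ,_) (opposite≢⇒≡ s s′ s̄≢s′)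

remQuot-injective : ∀ {n} → Injective _≡_ _≡_ (remQuot {n} 2)
remQuot-injective {n} {x} {y} eq = begin
  x                                 ≡⟨ sym (combine-remQuot {n} 2 x) ⟩
  uncurry combine (remQuot {n} 2 x) ≡⟨ cong (uncurry combine) eq ⟩
  uncurry combine (remQuot {n} 2 y) ≡⟨ combine-remQuot {n} 2 y ⟩
  y                                 ∎
  where open ≡-Reasoning

matching-bounds : ∀ n → TDCBounds (MatchingAdj n) (n * 2)
matching-bounds n =
  record { coloring = colour , proper , nonempty , dominating ; lower = lower }
  where
  colour : Fin n × Fin 2 → Fin (n * 2)
  colour = uncurry combine
  proper : Proper (MatchingAdj n) colour
  proper (t , s) (t′ , s′) (_ , s≢s′) = s≢s′ ∘ proj₂ ∘ combine-injective t s t′ s′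
  nonempty : AllClassesNonempty colour
  nonempty i = remQuot {n} 2 i , combine-remQuot {n} 2 i
  dominating : TotallyDominating (MatchingAdj n) colour
  dominating (t , s) = colour (partner (t , s)) , λ { (t′ , s′) eq →
    let t′≡t , s′≡s̄ = combine-injective t′ s′ t (opposite s) eq
    in sym t′≡t , λ s≡s′ → ≢opposite s (trans s≡s′ s′≡s̄) }
  lower : ∀ {m} → WeakTDColoring (MatchingAdj n) m → n * 2 ≤ m
  lower w = injective⇒≤ (WeakTDColoring.pendant-dominators-injective w
    (partner ∘ remQuot {n} 2) (remQuot {n} 2) remQuot-injective
    (λ x → partner-unique-neighbour (remQuot {n} 2 x)))

-- F_n = K₁ + nK₂

cone-over-matching-bounds : ∀ {k} → TDCBounds (ConeAdj (MatchingAdj (suc k))) 3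
cone-over-matching-bounds {k} =
  record { coloring = colour , proper , nonempty , dominating ; lower = lower }
  where
  colour : Maybe (Fin (suc k) × Fin 2) → Fin 3
  colour nothing        = zero
  colour (just (_ , s)) = suc s
  proper : Proper (ConeAdj (MatchingAdj (suc k))) colour
  proper nothing  nothing  ()
  proper nothing  (just _) _ ()
  proper (just _) nothing  _ ()
  proper (just _) (just _) (_ , s≢s′) = s≢s′ ∘ suc-injective
  nonempty : AllClassesNonempty colour
  nonempty zero    = nothing , refl
  nonempty (suc s) = just (zero , s) , refl
  dominating : TotallyDominating (ConeAdj (MatchingAdj (suc k))) colour
  dominating nothing  = suc zero , λ { nothing () ; (just _) _ → tt }
  dominating (just _) = zero , λ { nothing _ → tt ; (just _) () }
  lower : ∀ {m} → WeakTDColoring (ConeAdj (MatchingAdj (suc k))) m → 3 ≤ m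
  lower w = triangle⇒3≤ (WeakTDColoring.proper w)
    {nothing} {just (zero , zero)} {just (zero , suc zero)} tt tt (refl , λ ())

module _ {n : ℕ} where

  onPage : Fin (suc n) → Fin 2
  onPage zero    = zero
  onPage (suc _) = suc zero

  star-onPage : ∀ {i j} → StarAdj n i j → onPage i ≢ onPage j
  star-onPage {zero}  {suc _} _ ()
  star-onPage {suc _} {zero}  _ ()

  book-colour : Fin (suc n) × Fin 2 → Fin 4
  book-colour (i , s) = combine (onPage i) s

  book-colour-injective : ∀ i s j t → book-colour (i , s) ≡ book-colour (j , t) →
                          onPage i ≡ onPage j × s ≡ t
  book-colour-injective i s j t = combine-injective (onPage i) s (onPage j) t

  spine-class : ∀ u t → book-colour u ≡ book-colour (zero , t) → u ≡ (zero , t)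
  spine-class (zero  , s) t eq = cong (zero ,_) (proj₂ (book-colour-injective zero s zero t eq))
  spine-class (suc i , s) t eq with () ← proj₁ (book-colour-injective (suc i) s zero t eq)

  book-coloring : Fin n → HasTDColoring (BookModelAdj n) 4
  book-coloring page = book-colour , proper , nonempty , dominating
    where
    proper : Proper (BookModelAdj n) book-colour
    proper (i , s) (j , t) (inj₁ (_ , s≢t)) =
      s≢t ∘ proj₂ ∘ book-colour-injective i s j t
    proper (i , s) (j , t) (inj₂ (ij , _)) =
      star-onPage ij ∘ proj₁ ∘ book-colour-injective i s j t
    nonempty : AllClassesNonempty book-colour
    nonempty zero                   = (zero , zero) , refl
    nonempty (suc zero)             = (zero , suc zero) , refl
    nonempty (suc (suc zero))       = (suc page , zero) , refl
    nonempty (suc (suc (suc zero))) = (suc page , suc zero) , refl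
    dominated-by-spine : ∀ v t → BookModelAdj n v (zero , t) →
                         ∀ u → book-colour u ≡ book-colour (zero , t) → BookModelAdj n v u
    dominated-by-spine v t e u eq = subst (BookModelAdj n v) (sym (spine-class u t eq)) e
    dominating : TotallyDominating (BookModelAdj n) book-colour
    dominating (zero , s) = _ ,
      dominated-by-spine (zero , s) (opposite s) (inj₁ (refl , ≢opposite s))
    dominating (suc i , s) = _ , dominated-by-spine (suc i , s) s (inj₂ (tt , refl))

  leaves-of-other-pages : ∀ {i j s t} → i ≢ j → ¬ BookModelAdj n (suc i , s) (suc j , t)
  leaves-of-other-pages i≢j (inj₁ (eq , _)) = i≢j (suc-injective eq)
  leaves-of-other-pages i≢j (inj₂ (() , _))

  leaves-of-one-side : ∀ {i j s} → ¬ BookModelAdj n (suc i , s) (suc j , s)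
  leaves-of-one-side (inj₁ (_ , s≢s)) = s≢s refl
  leaves-of-one-side (inj₂ (() , _))

  leaf-spine-other-side : ∀ {i s t} → s ≢ t → ¬ BookModelAdj n (suc i , s) (zero , t)
  leaf-spine-other-side s≢t (inj₁ (() , _))
  leaf-spine-other-side s≢t (inj₂ (_ , s≡t)) = s≢t s≡t

  common-neighbour-of-bottom-leaves : ∀ {i j u} → i ≢ j →
    BookModelAdj n (suc i , zero) u → BookModelAdj n (suc j , zero) u → u ≡ (zero , zero)
  common-neighbour-of-bottom-leaves i≢j (inj₁ (refl , _)) e =
    ⊥-elim (leaves-of-other-pages (i≢j ∘ sym) e)
  common-neighbour-of-bottom-leaves {u = zero , _} i≢j (inj₂ (_ , refl)) _ = refl

book-lower : ∀ {k m} → WeakTDColoring (BookModelAdj (3 + k)) m → 4 ≤ m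
book-lower {k} {m} w = by-cases (dominator x₀ ≟ dominator x₁)
  where
  open WeakTDColoring w
  x y : Fin (3 + k) → Fin (4 + k) × Fin 2
  x i = suc i , zero
  y i = suc i , suc zero
  x₀ x₁ y₀ y₁ y₂ : Fin (4 + k) × Fin 2
  x₀ = x zero
  x₁ = x (suc zero)
  y₀ = y zero
  y₁ = y (suc zero)
  y₂ = y (suc (suc zero))

  separate : dominator x₀ ≢ dominator x₁ → 4 ≤ m
  separate Dx₀≢Dx₁ = distinct₄⇒4≤ Dx₀≢Dx₁
    (dominator≢colour (leaf-spine-other-side λ ()))
    (dominator≢colour (leaves-of-other-pages λ ()))
    (dominator≢colour (leaf-spine-other-side λ ()))
    (dominator≢colour (leaves-of-other-pages λ ()))
    (proper (zero , suc zero) y₂ (inj₂ (tt , refl)))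

  -- A class dominating both x₀ and x₁ can only reach their unique common neighbour, the
  -- hub (0 , 0), which no top leaf y i sees.
  shared : dominator x₀ ≡ dominator x₁ → 4 ≤ m
  shared Dx₀≡Dx₁ = by-cases′ (dominator y₀ ≟ dominator y₁)
    where
    rep-hub : rep (dominator x₀) ≡ (zero , zero)
    rep-hub = common-neighbour-of-bottom-leaves {i = zero} {j = suc zero} (λ ())
      (dominates-rep x₀) (subst (BookModelAdj _ x₁ ∘ rep) (sym Dx₀≡Dx₁) (dominates-rep x₁))
    Dx₀≢Dy : ∀ i → dominator x₀ ≢ dominator (y i)
    Dx₀≢Dy i eq = leaf-spine-other-side (λ ())
      (subst (BookModelAdj _ (y i)) (trans (cong rep (sym eq)) rep-hub) (dominates-rep (y i)))
    Dx₀≢cy₀ : dominator x₀ ≢ colour y₀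
    Dx₀≢cy₀ eq = dominator≢colour (leaves-of-other-pages λ ()) (trans (sym Dx₀≡Dx₁) eq)
    by-cases′ : Dec (dominator y₀ ≡ dominator y₁) → 4 ≤ m
    by-cases′ (no Dy₀≢Dy₁) = distinct₄⇒4≤ (Dx₀≢Dy zero) (Dx₀≢Dy (suc zero)) Dx₀≢cy₀ Dy₀≢Dy₁
      (dominator≢colour leaves-of-one-side)
      (dominator≢colour leaves-of-one-side)
    by-cases′ (yes Dy₀≡Dy₁) = distinct₄⇒4≤ (Dx₀≢Dy zero)
      (dominator≢colour leaves-of-one-side) Dx₀≢cy₀
      (λ eq → dominator≢colour (leaves-of-other-pages λ ()) (trans (sym Dy₀≡Dy₁) eq))
      (dominator≢colour leaves-of-one-side)
      (proper x₀ y₀ (inj₁ (refl , λ ())))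

  by-cases : Dec (dominator x₀ ≡ dominator x₁) → 4 ≤ m
  by-cases (no Dx₀≢Dx₁)  = separate Dx₀≢Dx₁
  by-cases (yes Dx₀≡Dx₁) = shared Dx₀≡Dx₁

book-bounds : ∀ {k} → TDCBounds (BookModelAdj (3 + k)) 4
book-bounds = record { coloring = book-coloring zero ; lower = book-lower }

module _ {n : ℕ} where

  inner outer : Fin n → Maybe (Fin n × Fin 2)
  inner i = just (i , suc zero)
  outer i = just (i , zero)

  inner-injective : Injective _≡_ _≡_ inner
  inner-injective refl = refl

  outer-pendant : ∀ i {u} → SubdividedStarAdj n (outer i) u → u ≡ inner i
  outer-pendant i {nothing}               ()
  outer-pendant i {just (.i , zero)}      (refl , 0≢0) = ⊥-elim (0≢0 refl)
  outer-pendant i {just (.i , suc zero)}  (refl , _)   = refl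

  spider-coloring : Fin n → HasTDColoring (SubdividedStarAdj n) (2 + n)
  spider-coloring leaf = colour , proper , nonempty , dominating
    where
    colour : Maybe (Fin n × Fin 2) → Fin (2 + n)
    colour nothing               = zero
    colour (just (_ , zero))     = suc zero
    colour (just (i , suc zero)) = suc (suc i)
    proper : Proper (SubdividedStarAdj n) colour
    proper nothing               nothing               ()
    proper nothing               (just (_ , zero))     ()
    proper nothing               (just (_ , suc zero)) _ ()
    proper (just (_ , zero))     nothing               ()
    proper (just (_ , suc zero)) nothing               _ ()
    proper (just (_ , zero))     (just (_ , zero))     (_ , 0≢0) = ⊥-elim (0≢0 refl)
    proper (just (_ , zero))     (just (_ , suc zero)) _ ()
    proper (just (_ , suc zero)) (just (_ , zero))     _ ()
    proper (just (_ , suc zero)) (just (_ , suc zero)) (_ , 1≢1) = ⊥-elim (1≢1 refl)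
    nonempty : AllClassesNonempty colour
    nonempty zero          = nothing , refl
    nonempty (suc zero)    = outer leaf , refl
    nonempty (suc (suc i)) = inner i , refl
    dominating : TotallyDominating (SubdividedStarAdj n) colour
    dominating nothing = suc (suc leaf) , λ
      { nothing () ; (just (_ , zero)) () ; (just (_ , suc zero)) _ → refl }
    dominating (just (i , zero)) = suc (suc i) , λ
      { nothing () ; (just (_ , zero)) ()
      ; (just (_ , suc zero)) eq → sym (suc-injective (suc-injective eq)) , λ () }
    dominating (just (_ , suc zero)) = zero , λ
      { nothing _ → refl ; (just (_ , zero)) () ; (just (_ , suc zero)) () }

spider-lower : ∀ {k m} → WeakTDColoring (SubdividedStarAdj (2 + k)) m → 4 + k ≤ m
spider-lower {k} {m} w = by-cases (dominator (inner zero) ≟ dominator (inner (suc zero)))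
  where
  open WeakTDColoring w
  D-outer : Fin (2 + k) → Fin m
  D-outer = dominator ∘ outer
  D-outer-injective : Injective _≡_ _≡_ D-outer
  D-outer-injective = pendant-dominators-injective outer inner inner-injective outer-pendant
  D-inner∉D-outer : ∀ a j → dominator (inner a) ≢ D-outer j
  D-inner∉D-outer a j eq = proj₂ (subst (SubdividedStarAdj _ (inner a))
    (trans (cong rep eq) (rep-dominator-of-pendant (outer-pendant j)))
    (dominates-rep (inner a))) refl
  by-cases : Dec (dominator (inner zero) ≡ dominator (inner (suc zero))) → 4 + k ≤ m
  by-cases (no D₀≢D₁) = two-outside-image⇒2+n≤ D₀≢D₁
    (D-inner∉D-outer zero) (D-inner∉D-outer (suc zero)) D-outer-injective
  by-cases (yes D₀≡D₁) = two-outside-image⇒2+n≤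
    (λ eq → dominator≢colour {u = outer zero} (λ { (() , _) }) (trans (sym D₀≡D₁) eq))
    (D-inner∉D-outer zero)
    (λ j → dominator≢colour {u = outer zero} (λ { (_ , 0≢0) → 0≢0 refl }) ∘ sym)
    D-outer-injective

spider-bounds : ∀ {k} → TDCBounds (SubdividedStarAdj (2 + k)) (4 + k)
spider-bounds = record { coloring = spider-coloring zero ; lower = spider-lower }

-- F_n, B_n and their hub-deleted subgraphs retract onto the models

friendship-retraction : ∀ n → FullRetraction (FriendshipAdj n) (ConeAdj (MatchingAdj n))
friendship-retraction n = full-retraction-by-≡ to from to∘from same-adjacency
  where
  to : Fin (suc (n * 2)) → Maybe (Fin n × Fin 2)
  to zero    = nothing
  to (suc x) = just (remQuot {n} 2 x)
  from : Maybe (Fin n × Fin 2) → Fin (suc (n * 2))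
  from nothing        = zero
  from (just (t , s)) = suc (combine t s)
  to∘from : ∀ v → to (from v) ≡ v
  to∘from nothing        = refl
  to∘from (just (t , s)) = cong just (remQuot-combine t s)
  same-adjacency : ∀ u w → FriendshipAdj n u w ≡ ConeAdj (MatchingAdj n) (to u) (to w)
  same-adjacency zero    zero    = refl
  same-adjacency zero    (suc _) = refl
  same-adjacency (suc _) zero    = refl
  same-adjacency (suc _) (suc _) = refl

friendship-minus-hub-retraction :
  ∀ n → FullRetraction (RemAdj (Friendship n) ⁅ zero ⁆) (MatchingAdj n)
friendship-minus-hub-retraction n = full-retraction-by-≡ to from to∘from same-adjacency
  where
  to : RemV {suc (n * 2)} ⁅ zero ⁆ → Fin n × Fin 2
  to (zero  , 0∉) = ⊥-elim (0∉ (x∈⁅x⁆ zero))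
  to (suc x , _)  = remQuot {n} 2 x
  from : Fin n × Fin 2 → RemV {suc (n * 2)} ⁅ zero ⁆
  from (t , s) = suc (combine t s) , x≢y⇒x∉⁅y⁆ {y = zero} λ ()
  to∘from : ∀ v → to (from v) ≡ v
  to∘from (t , s) = remQuot-combine t s
  same-adjacency : ∀ u w → RemAdj (Friendship n) ⁅ zero ⁆ u w ≡ MatchingAdj n (to u) (to w)
  same-adjacency (zero  , 0∉) _            = ⊥-elim (0∉ (x∈⁅x⁆ zero))
  same-adjacency (suc _ , _)  (zero  , 0∉) = ⊥-elim (0∉ (x∈⁅x⁆ zero))
  same-adjacency (suc _ , _)  (suc _ , _)  = refl

book-retraction : ∀ n → FullRetraction (BookAdj n) (BookModelAdj n)
book-retraction n = full-retraction-by-≡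
  (remQuot {suc n} 2) (uncurry combine) (uncurry remQuot-combine) (λ _ _ → refl)

module _ {n : ℕ} where

  hub : Fin (suc n) × Fin 2
  hub = zero , zero

  toSpider : Fin (suc n) × Fin 2 → Maybe (Fin n × Fin 2)
  toSpider (zero  , _) = nothing
  toSpider (suc i , s) = just (i , s)

  toSpider-preserves : ∀ q q′ → q ≢ hub → q′ ≢ hub →
    BookModelAdj n q q′ → SubdividedStarAdj n (toSpider q) (toSpider q′)
  toSpider-preserves (zero , zero) _ q≢hub _ _ = ⊥-elim (q≢hub refl)
  toSpider-preserves _ (zero , zero) _ q′≢hub _ = ⊥-elim (q′≢hub refl)
  toSpider-preserves (zero , suc zero) (zero , suc zero) _ _ (inj₁ (_ , 1≢1)) = ⊥-elim (1≢1 refl)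
  toSpider-preserves (zero , suc zero) (zero , suc zero) _ _ (inj₂ (() , _))
  toSpider-preserves (zero , suc zero) (suc _ , _) _ _ (inj₁ (() , _))
  toSpider-preserves (zero , suc zero) (suc _ , _) _ _ (inj₂ (_ , 1≡t)) = sym 1≡t
  toSpider-preserves (suc _ , _) (zero , suc zero) _ _ (inj₁ (() , _))
  toSpider-preserves (suc _ , _) (zero , suc zero) _ _ (inj₂ (_ , s≡1)) = s≡1
  toSpider-preserves (suc _ , _) (suc _ , _) _ _ (inj₁ (i≡j , s≢t)) = suc-injective i≡j , s≢t
  toSpider-preserves (suc _ , _) (suc _ , _) _ _ (inj₂ (() , _))

  toSpider-reflects : ∀ q q′ → q ≢ hub → q′ ≢ hub →
    SubdividedStarAdj n (toSpider q) (toSpider q′) → BookModelAdj n q q′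
  toSpider-reflects (zero , zero) _ q≢hub _ _ = ⊥-elim (q≢hub refl)
  toSpider-reflects _ (zero , zero) _ q′≢hub _ = ⊥-elim (q′≢hub refl)
  toSpider-reflects (zero , suc zero) (zero , suc zero) _ _ ()
  toSpider-reflects (zero , suc zero) (suc _ , _) _ _ t≡1 = inj₂ (tt , sym t≡1)
  toSpider-reflects (suc _ , _) (zero , suc zero) _ _ s≡1 = inj₂ (tt , s≡1)
  toSpider-reflects (suc _ , _) (suc _ , _) _ _ (i≡j , s≢t) = inj₁ (cong suc i≡j , s≢t)

book-minus-hub-retraction :
  ∀ n → FullRetraction (RemAdj (Book n) ⁅ zero ⁆) (SubdividedStarAdj n)
book-minus-hub-retraction n = record
  { to        = toSpider ∘ remQuot {suc n} 2 ∘ proj₁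
  ; from      = from
  ; to∘from   = to∘from
  ; preserves = λ {u} {w} → toSpider-preserves _ _ (off-hub u) (off-hub w)
  ; reflects  = λ {u} {w} → toSpider-reflects _ _ (off-hub u) (off-hub w)
  }
  where
  off-hub : ∀ (u : RemV {suc n * 2} ⁅ zero ⁆) → remQuot {suc n} 2 (proj₁ u) ≢ hub
  off-hub (x , x∉) eq = x∉ (subst (_∈ ⁅ zero ⁆) x≡0 (x∈⁅x⁆ zero))
    where
    x≡0 : zero ≡ x
    x≡0 = trans (cong (uncurry combine) (sym eq)) (combine-remQuot {suc n} 2 x)
  from : Maybe (Fin n × Fin 2) → RemV {suc n * 2} ⁅ zero ⁆
  from nothing        = combine {suc n} zero (suc zero) , x≢y⇒x∉⁅y⁆ {y = zero} λ ()
  from (just (i , s)) = combine {suc n} (suc i) s , x≢y⇒x∉⁅y⁆ {y = zero} λ ()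
  to∘from : ∀ v → toSpider (remQuot {suc n} 2 (proj₁ (from v))) ≡ v
  to∘from nothing        = cong toSpider (remQuot-combine {suc n} zero (suc zero))
  to∘from (just (i , s)) = cong toSpider (remQuot-combine {suc n} (suc i) s)

theorem4p4 : (∀ (n : ℕ) → 2 ≤ n → IsTDCStability (Friendship n) 1) × (∀ (n : ℕ) → 3 ≤ n → IsTDCStability (Book n) 1)
theorem4p4 = friendship , book
  where
  friendship : ∀ n → 2 ≤ n → IsTDCStability (Friendship n) 1
  friendship (suc zero) (s≤s ())
  friendship (suc (suc k)) _ = tdcStability≡1 zero
    (friendship-retraction _) cone-over-matching-bounds
    (friendship-minus-hub-retraction _) (matching-bounds _) λ ()
  book : ∀ n → 3 ≤ n → IsTDCStability (Book n) 1
  book (suc (suc zero)) (s≤s (s≤s ()))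
  book (suc (suc (suc k))) _ = tdcStability≡1 zero
    (book-retraction _) book-bounds
    (book-minus-hub-retraction _) spider-bounds λ ()
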